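{- Let $G$ be a graph and $P$ a subset of its vertices. If for every subset $U\subseteq P$ with $|U|\geq 2$ there exist two vertices of $U$ at distance at least $2|U|-1$ in $G$, then $P$ is a multipacking of $G$.
   Context: For a graph $G=(V,E)$, the ball of radius $r$ around $v$ is $N_r(v)=\{u\in V : d_G(u,v)\leq r\}$. A multipacking of $G$ is a set $P\subseteq V$ such that for every vertex $v$ and every positive integer $r$, $|N_r(v)\cap P|\leq r$. -}

module Defs where

open import Data.Nat using (ℕ; zero; suc; _≤_; _*_; _∸_)
open import Data.Fin using (Fin)
open import Data.Fin.Subset using (Subset; _∈_)
open import Data.List using (List; length)
open import Data.List.Relation.Unary.All using (All)
open import Data.List.Relation.Unary.Unique.Propositional using (Unique)
open import Data.Product using (Σ; _×_)
open import Relation.Nullary using (¬_)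
open import Relation.Binary.PropositionalEquality using (_≡_)

record Graph (n : ℕ) : Set₁ where
  field
    Adj     : Fin n → Fin n → Set
    symm    : ∀ {u v} → Adj u v → Adj v u
    irrefl  : ∀ {u} → ¬ Adj u u

open Graph public

data Walk {n : ℕ} (G : Graph n) : Fin n → Fin n → ℕ → Set where
  nil  : ∀ {u} → Walk G u u zero
  cons : ∀ {u v w k} → Adj G u v → Walk G v w k → Walk G u w (suc k)

-- d_G(u,v) ≤ r  (the distance is the least length of a walk; infinite if none).
Dist≤ : {n : ℕ} → Graph n → Fin n → Fin n → ℕ → Set
Dist≤ G u v r = Σ ℕ λ k → k ≤ r × Walk G u v k

-- |N_r(v) ∩ P| ≤ r : every duplicate-free list of vertices of N_r(v) ∩ P has length ≤ r.
BallCapBound : {n : ℕ} → Graph n → Subset n → Fin n → ℕ → Set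
BallCapBound {n} G P v r =
  (xs : List (Fin n)) → Unique xs → All (λ u → u ∈ P × Dist≤ G u v r) xs → length xs ≤ r


Multipacking : {n : ℕ} → Graph n → Subset n → Set
Multipacking G P = ∀ v (r : ℕ) → 1 ≤ r → BallCapBound G P v r

-- Take a duplicate-free list xs of vertices of P inside the ball N_r(v) and
-- suppose |xs| > r ≥ 1.  Any two of its vertices are joined through v by a walk
-- of length at most 2r ≤ 2|xs| − 2, contradicting the hypothesis applied to xs.
module Submission where

open import Defs
open import Data.Nat using (ℕ; suc; _≤_; _<_; _*_; _∸_; _+_; _≤?_; s≤s)
open import Data.Nat.Properties
  using (+-comm; +-identityʳ; +-mono-≤; *-distribˡ-∸; ≤-trans; ≰⇒>; module ≤-Reasoning)
open import Data.Fin using (Fin)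
open import Data.Fin.Subset using (Subset; _∈_)
open import Data.List using (List; length)
open import Data.List.Relation.Unary.All as All using (All)
open import Data.List.Relation.Unary.Unique.Propositional using (Unique)
open import Data.List.Membership.Propositional using () renaming (_∈_ to _∈ₗ_)
open import Data.Empty using (⊥-elim)
open import Data.Product using (Σ; _×_; _,_; proj₁; proj₂)
open import Relation.Nullary using (¬_; yes; no)
open import Relation.Binary.PropositionalEquality using (sym; cong; subst)

module _ {n : ℕ} {G : Graph n} where

  _++ʷ_ : ∀ {u v w j k} → Walk G u v j → Walk G v w k → Walk G u w (j + k)
  nil      ++ʷ q = q
  cons a p ++ʷ q = cons a (p ++ʷ q)

  reverseʷ : ∀ {u v k} → Walk G u v k → Walk G v u k
  reverseʷ nil                    = nil
  reverseʷ {k = suc k} (cons a p) =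
    subst (Walk G _ _) (+-comm k 1) (reverseʷ p ++ʷ cons (symm G a) nil)

  dist≤-sym : ∀ {u v r} → Dist≤ G u v r → Dist≤ G v u r
  dist≤-sym (k , k≤r , p) = k , k≤r , reverseʷ p

  dist≤-trans : ∀ {u v w r s} → Dist≤ G u v r → Dist≤ G v w s → Dist≤ G u w (r + s)
  dist≤-trans (j , j≤r , p) (k , k≤s , q) = j + k , +-mono-≤ j≤r k≤s , p ++ʷ q

  dist≤-mono : ∀ {u v r s} → r ≤ s → Dist≤ G u v r → Dist≤ G u v s
  dist≤-mono r≤s (k , k≤r , p) = k , ≤-trans k≤r r≤s , p

  dist≤-through-centre : ∀ {u v w r} → Dist≤ G u v r → Dist≤ G w v r → Dist≤ G u w (r + r)
  dist≤-through-centre du dw = dist≤-trans du (dist≤-sym dw)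

m<n⇒m+m≤2*n∸2 : ∀ {m n} → m < n → m + m ≤ 2 * n ∸ 2
m<n⇒m+m≤2*n∸2 {m} {suc n} (s≤s m≤n) = begin
  m + m          ≤⟨ +-mono-≤ m≤n m≤n ⟩
  n + n          ≡⟨ cong (n +_) (sym (+-identityʳ n)) ⟩
  2 * n          ≡⟨ *-distribˡ-∸ 2 (suc n) 1 ⟩
  2 * suc n ∸ 2  ∎
  where open ≤-Reasoning

lemma7 : {n : ℕ} (G : Graph n) (P : Subset n) →
    ((U : List (Fin n)) → Unique U → All (_∈ P) U → 2 ≤ length U →
    Σ (Fin n) λ u → Σ (Fin n) λ w →
    u ∈ₗ U × w ∈ₗ U × ¬ Dist≤ G u w (2 * length U ∸ 2)) →
    Multipacking G P
lemma7 G P far-pair v r 1≤r xs unique-xs xs⊆P∩ball with length xs ≤? r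
... | yes |xs|≤r = |xs|≤r
... | no  |xs|≰r
  with r<|xs| ← ≰⇒> |xs|≰r
  with u , w , u∈xs , w∈xs , far ←
         far-pair xs unique-xs (All.map proj₁ xs⊆P∩ball) (≤-trans (s≤s 1≤r) r<|xs|)
  = ⊥-elim (far (dist≤-mono (m<n⇒m+m≤2*n∸2 r<|xs|)
                   (dist≤-through-centre (inBall u∈xs) (inBall w∈xs))))
  where
  inBall : ∀ {x} → x ∈ₗ xs → Dist≤ G x v r
  inBall x∈xs = proj₂ (All.lookup xs⊆P∩ball x∈xs)
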